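{- Let $\phi,\psi,\chi\in\mathcal{L}$. In $\mathbb{ICK}$: (Nec) from $\phi$ one can derive $\psi\mathbin{\Box\!\!\to}\phi$; (RM$\Box$) from $\phi\to\psi$ one can derive $(\chi\mathbin{\Box\!\!\to}\phi)\to(\chi\mathbin{\Box\!\!\to}\psi)$; (RM$\Diamond$) from $\phi\to\psi$ one can derive $(\chi\mathbin{\Diamond\!\!\to}\phi)\to(\chi\mathbin{\Diamond\!\!\to}\psi)$; and the following are theorems: (T1) $(\phi\mathbin{\Box\!\!\to}(\psi\to\chi))\to((\phi\mathbin{\Box\!\!\to}\psi)\to(\phi\mathbin{\Box\!\!\to}\chi))$; (T2) $(\phi\mathbin{\Box\!\!\to}(\psi\to\chi))\to((\phi\mathbin{\Diamond\!\!\to}\psi)\to(\phi\mathbin{\Diamond\!\!\to}\chi))$; (T3) $(\phi\mathbin{\Box\!\!\to}\psi)\to((\phi\mathbin{\Diamond\!\!\to}(\psi\to\chi))\to(\phi\mathbin{\Diamond\!\!\to}\chi))$; (T4) $\neg(\phi\mathbin{\Diamond\!\!\to}\psi)\leftrightarrow(\phi\mathbin{\Box\!\!\to}\neg\psi)$.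
   Context: $\mathcal{L}$ is built from propositional variables and $\top,\bot$ by $\wedge,\vee,\to$ and connectives $\phi\mathbin{\Box\!\!\to}\psi$, $\phi\mathbin{\Diamond\!\!\to}\psi$; $\neg\phi:=\phi\to\bot$, $\leftrightarrow$ as usual. The Hilbert system $\mathbb{ICK}$ has axioms: (A0) all $\mathcal{L}$-instances of a complete axiomatization of intuitionistic propositional logic; (A1) $((\phi\mathbin{\Box\!\!\to}\psi)\wedge(\phi\mathbin{\Box\!\!\to}\chi))\leftrightarrow(\phi\mathbin{\Box\!\!\to}(\psi\wedge\chi))$; (A2) $((\phi\mathbin{\Diamond\!\!\to}\psi)\wedge(\phi\mathbin{\Box\!\!\to}\chi))\to(\phi\mathbin{\Diamond\!\!\to}(\psi\wedge\chi))$; (A3) $(\phi\mathbin{\Diamond\!\!\to}(\psi\vee\chi))\leftrightarrow((\phi\mathbin{\Diamond\!\!\to}\psi)\vee(\phi\mathbin{\Diamond\!\!\to}\chi))$; (A4) $((\phi\mathbin{\Diamond\!\!\to}\psi)\to(\phi\mathbin{\Box\!\!\to}\chi))\to(\phi\mathbin{\Box\!\!\to}(\psi\to\chi))$; (A5) $\phi\mathbin{\Box\!\!\to}\top$; (A6) $\neg(\phi\mathbin{\Diamond\!\!\to}\bot)$; rules: modus ponens; from $\phi\leftrightarrow\psi$ infer $(\phi\mathbin{\Box\!\!\to}\chi)\leftrightarrow(\psi\mathbin{\Box\!\!\to}\chi)$; from $\phi\leftrightarrow\psi$ infer $(\chi\mathbin{\Box\!\!\to}\phi)\leftrightarrow(\chi\mathbin{\Box\!\!\to}\psi)$;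 and the same two with $\mathbin{\Diamond\!\!\to}$. "From $\alpha$ one can derive $\beta$" means there is a finite sequence ending in $\beta$ each member of which is $\alpha$, a theorem of $\mathbb{ICK}$, or obtained from earlier members by one of the rules. -}

module Defs where

open import Data.Nat using (ℕ)

infixr 5 _⇒_
infixr 6 _∨'_
infixr 7 _∧'_
infix  8 _□→_ _◇→_

data Form : Set where
  var   : ℕ → Form
  ⊤'    : Form
  ⊥'    : Form
  _∧'_  : Form → Form → Form
  _∨'_  : Form → Form → Form
  _⇒_   : Form → Form → Form
  _□→_  : Form → Form → Form
  _◇→_  : Form → Form → Form

¬' : Form → Form
¬' φ = φ ⇒ ⊥'

_⇔_ : Form → Form → Form
φ ⇔ ψ = (φ ⇒ ψ) ∧' (ψ ⇒ φ)

-- Axioms of ICK.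
-- (A0) is instantiated with the standard complete Hilbert axiomatization of
-- intuitionistic propositional logic (over ⊤, ⊥, ∧, ∨, →), all L-instances.
data Axiom : Form → Set where
  ipc-k     : ∀ φ ψ → Axiom (φ ⇒ (ψ ⇒ φ))
  ipc-s     : ∀ φ ψ χ → Axiom ((φ ⇒ (ψ ⇒ χ)) ⇒ ((φ ⇒ ψ) ⇒ (φ ⇒ χ)))
  ipc-∧e₁   : ∀ φ ψ → Axiom ((φ ∧' ψ) ⇒ φ)
  ipc-∧e₂   : ∀ φ ψ → Axiom ((φ ∧' ψ) ⇒ ψ)
  ipc-∧i    : ∀ φ ψ → Axiom (φ ⇒ (ψ ⇒ (φ ∧' ψ)))
  ipc-∨i₁   : ∀ φ ψ → Axiom (φ ⇒ (φ ∨' ψ))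
  ipc-∨i₂   : ∀ φ ψ → Axiom (ψ ⇒ (φ ∨' ψ))
  ipc-∨e    : ∀ φ ψ χ → Axiom ((φ ⇒ χ) ⇒ ((ψ ⇒ χ) ⇒ ((φ ∨' ψ) ⇒ χ)))
  ipc-⊥e    : ∀ φ → Axiom (⊥' ⇒ φ)
  ipc-⊤i    : Axiom ⊤'
  A1 : ∀ φ ψ χ → Axiom (((φ □→ ψ) ∧' (φ □→ χ)) ⇔ (φ □→ (ψ ∧' χ)))
  A2 : ∀ φ ψ χ → Axiom (((φ ◇→ ψ) ∧' (φ □→ χ)) ⇒ (φ ◇→ (ψ ∧' χ)))
  A3 : ∀ φ ψ χ → Axiom ((φ ◇→ (ψ ∨' χ)) ⇔ ((φ ◇→ ψ) ∨' (φ ◇→ χ)))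
  A4 : ∀ φ ψ χ → Axiom (((φ ◇→ ψ) ⇒ (φ □→ χ)) ⇒ (φ □→ (ψ ⇒ χ)))
  A5 : ∀ φ → Axiom (φ □→ ⊤')
  A6 : ∀ φ → Axiom (¬' (φ ◇→ ⊥'))

data ⊢_ : Form → Set where
  ax   : ∀ {φ} → Axiom φ → ⊢ φ
  mp   : ∀ {φ ψ} → ⊢ (φ ⇒ ψ) → ⊢ φ → ⊢ ψ
  □-l  : ∀ {φ ψ} χ → ⊢ (φ ⇔ ψ) → ⊢ ((φ □→ χ) ⇔ (ψ □→ χ))
  □-r  : ∀ {φ ψ} χ → ⊢ (φ ⇔ ψ) → ⊢ ((χ □→ φ) ⇔ (χ □→ ψ))
  ◇-l  : ∀ {φ ψ} χ → ⊢ (φ ⇔ ψ) → ⊢ ((φ ◇→ χ) ⇔ (ψ ◇→ χ))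
  ◇-r  : ∀ {φ ψ} χ → ⊢ (φ ⇔ ψ) → ⊢ ((χ ◇→ φ) ⇔ (χ ◇→ ψ))

-- "From α one can derive β": β is reachable from α and theorems of ICK by
-- the rules (inductive rendering of the finite-sequence definition).
data _⊢from_ (α : Form) : Form → Set where
  hyp  : α ⊢from α
  thm  : ∀ {β} → ⊢ β → α ⊢from β
  mp   : ∀ {φ ψ} → α ⊢from (φ ⇒ ψ) → α ⊢from φ → α ⊢from ψ
  □-l  : ∀ {φ ψ} χ → α ⊢from (φ ⇔ ψ) → α ⊢from ((φ □→ χ) ⇔ (ψ □→ χ))
  □-r  : ∀ {φ ψ} χ → α ⊢from (φ ⇔ ψ) → α ⊢from ((χ □→ φ) ⇔ (χ □→ ψ))
  ◇-l  : ∀ {φ ψ} χ → α ⊢from (φ ⇔ ψ) → α ⊢from ((φ ◇→ χ) ⇔ (ψ ◇→ χ))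
  ◇-r  : ∀ {φ ψ} χ → α ⊢from (φ ⇔ ψ) → α ⊢from ((χ ◇→ φ) ⇔ (χ ◇→ ψ))

{-# OPTIONS --safe #-}
module Submission where

-- Propositional reasoning goes through the deduction theorem: a derivation
-- in context Γ is a theorem ⋀ Γ ⇒ φ.  The modal rules act only on
-- equivalences; since φ ⇒ ψ makes φ equivalent to φ ∧ ψ and ψ to ψ ∨ φ,
-- A1 and A3 give monotonicity of □→ and ◇→, and ⊤ ⇔ φ with A5 gives
-- necessitation.  T1–T3 are A1 or A2 followed by monotonicity; T4 is A4 one
-- way and T2 (with χ = ⊥) plus A6 the other.  A rule derivable from α becomes
-- a rule on theorems by substituting a proof of α for the hypothesis.

open import Defs
open import Data.Product using (_×_; _,_)
open import Data.List using (List; []; _∷_)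

K-rule : ∀ {φ ψ} → ⊢ φ → ⊢ (ψ ⇒ φ)
K-rule = mp (ax (ipc-k _ _))

S-rule : ∀ {φ ψ χ} → ⊢ (φ ⇒ (ψ ⇒ χ)) → ⊢ (φ ⇒ ψ) → ⊢ (φ ⇒ χ)
S-rule f = mp (mp (ax (ipc-s _ _ _)) f)

⇒-trans : ∀ {φ ψ χ} → ⊢ (φ ⇒ ψ) → ⊢ (ψ ⇒ χ) → ⊢ (φ ⇒ χ)
⇒-trans f g = S-rule (K-rule g) f

⇒-postcompose : ∀ {φ ψ χ} → ⊢ ((ψ ⇒ χ) ⇒ ((φ ⇒ ψ) ⇒ (φ ⇒ χ)))
⇒-postcompose = ⇒-trans (ax (ipc-k _ _)) (ax (ipc-s _ _ _))

⋀ : List Form → Form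
⋀ []      = ⊤'
⋀ (φ ∷ Γ) = ⋀ Γ ∧' φ

infix  3 _⊩_
infixl 9 _·_

data _⊩_ : List Form → Form → Set where
  vz  : ∀ {Γ φ} → φ ∷ Γ ⊩ φ
  vs  : ∀ {Γ φ ψ} → Γ ⊩ φ → ψ ∷ Γ ⊩ φ
  th  : ∀ {Γ φ} → ⊢ φ → Γ ⊩ φ
  lam : ∀ {Γ φ ψ} → φ ∷ Γ ⊩ ψ → Γ ⊩ φ ⇒ ψ
  _·_ : ∀ {Γ φ ψ} → Γ ⊩ φ ⇒ ψ → Γ ⊩ φ → Γ ⊩ ψ

deduction : ∀ {Γ φ} → Γ ⊩ φ → ⊢ (⋀ Γ ⇒ φ)
deduction vz      = ax (ipc-∧e₂ _ _)
deduction (vs p)  = ⇒-trans (ax (ipc-∧e₁ _ _)) (deduction p)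
deduction (th p)  = K-rule p
deduction (lam p) = S-rule (S-rule (K-rule ⇒-postcompose) (K-rule (deduction p))) (ax (ipc-∧i _ _))
deduction (f · p) = S-rule (deduction f) (deduction p)

closed : ∀ {φ} → [] ⊩ φ → ⊢ φ
closed p = mp (deduction p) (ax ipc-⊤i)

v1 : ∀ {Γ φ ψ} → ψ ∷ φ ∷ Γ ⊩ φ
v1 = vs vz

fst : ∀ {Γ φ ψ} → Γ ⊩ φ ∧' ψ → Γ ⊩ φ
fst p = th (ax (ipc-∧e₁ _ _)) · p

snd : ∀ {Γ φ ψ} → Γ ⊩ φ ∧' ψ → Γ ⊩ ψ
snd p = th (ax (ipc-∧e₂ _ _)) · p

pair : ∀ {Γ φ ψ} → Γ ⊩ φ → Γ ⊩ ψ → Γ ⊩ φ ∧' ψ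
pair p q = th (ax (ipc-∧i _ _)) · p · q

inl : ∀ {Γ φ ψ} → Γ ⊩ φ → Γ ⊩ φ ∨' ψ
inl p = th (ax (ipc-∨i₁ _ _)) · p

inr : ∀ {Γ φ ψ} → Γ ⊩ ψ → Γ ⊩ φ ∨' ψ
inr p = th (ax (ipc-∨i₂ _ _)) · p

cases : ∀ {Γ φ ψ χ} → Γ ⊩ φ ∨' ψ → Γ ⊩ φ ⇒ χ → Γ ⊩ ψ ⇒ χ → Γ ⊩ χ
cases p f g = th (ax (ipc-∨e _ _ _)) · f · g · p

efq : ∀ {Γ φ} → Γ ⊩ ⊥' → Γ ⊩ φ
efq p = th (ax (ipc-⊥e _)) · p

⇔-to : ∀ {Γ φ ψ} → Γ ⊩ φ ⇔ ψ → Γ ⊩ φ → Γ ⊩ ψ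
⇔-to e p = fst e · p

⇔-from : ∀ {Γ φ ψ} → Γ ⊩ φ ⇔ ψ → Γ ⊩ ψ → Γ ⊩ φ
⇔-from e p = snd e · p

⊢from-mp : ∀ {α φ ψ} → ⊢ (φ ⇒ ψ) → α ⊢from φ → α ⊢from ψ
⊢from-mp f = mp (thm f)

⊢from-cut : ∀ {α β} → ⊢ α → α ⊢from β → ⊢ β
⊢from-cut a hyp         = a
⊢from-cut a (thm p)     = p
⊢from-cut a (mp f p)    = mp (⊢from-cut a f) (⊢from-cut a p)
⊢from-cut a (□-l χ e)   = □-l χ (⊢from-cut a e)
⊢from-cut a (□-r χ e)   = □-r χ (⊢from-cut a e)
⊢from-cut a (◇-l χ e)   = ◇-l χ (⊢from-cut a e)
⊢from-cut a (◇-r χ e)   = ◇-r χ (⊢from-cut a e)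

□-nec : ∀ {α φ} ψ → α ⊢from φ → α ⊢from (ψ □→ φ)
□-nec {α} {φ} ψ p = ⊢from-mp (closed (lam (⇔-to vz (th (ax (A5 ψ)))))) (□-r ψ ⊤⇔φ)
  where
  ⊤⇔φ : α ⊢from (⊤' ⇔ φ)
  ⊤⇔φ = ⊢from-mp (closed (lam (pair (lam v1) (lam (th (ax ipc-⊤i)))))) p

□-mono : ∀ {α φ ψ} χ → α ⊢from (φ ⇒ ψ) → α ⊢from ((χ □→ φ) ⇒ (χ □→ ψ))
□-mono {α} {φ} {ψ} χ p =
  ⊢from-mp (closed (lam (lam (snd (⇔-from (th (ax (A1 χ φ ψ))) (⇔-to v1 vz))))))
           (□-r χ φ⇔φ∧ψ)
  where
  φ⇔φ∧ψ : α ⊢from (φ ⇔ (φ ∧' ψ))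
  φ⇔φ∧ψ = ⊢from-mp (closed (lam (pair (lam (pair vz (v1 · vz))) (lam (fst vz))))) p

◇-mono : ∀ {α φ ψ} χ → α ⊢from (φ ⇒ ψ) → α ⊢from ((χ ◇→ φ) ⇒ (χ ◇→ ψ))
◇-mono {α} {φ} {ψ} χ p =
  ⊢from-mp (closed (lam (lam (⇔-from v1 (⇔-from (th (ax (A3 χ ψ φ))) (inr vz))))))
           (◇-r χ ψ⇔ψ∨φ)
  where
  ψ⇔ψ∨φ : α ⊢from (ψ ⇔ (ψ ∨' φ))
  ψ⇔ψ∨φ = ⊢from-mp (closed (lam (pair (lam (inl vz)) (lam (cases vz (lam vz) v1))))) p

□-mono-⊢ : ∀ {φ ψ} χ → ⊢ (φ ⇒ ψ) → ⊢ ((χ □→ φ) ⇒ (χ □→ ψ))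
□-mono-⊢ χ f = ⊢from-cut f (□-mono χ hyp)

◇-mono-⊢ : ∀ {φ ψ} χ → ⊢ (φ ⇒ ψ) → ⊢ ((χ ◇→ φ) ⇒ (χ ◇→ ψ))
◇-mono-⊢ χ f = ⊢from-cut f (◇-mono χ hyp)

□-distrib-⇒ : ∀ φ ψ χ → ⊢ ((φ □→ (ψ ⇒ χ)) ⇒ ((φ □→ ψ) ⇒ (φ □→ χ)))
□-distrib-⇒ φ ψ χ = closed (lam (lam
  (th (□-mono-⊢ φ (closed (lam (fst vz · snd vz))))
   · (⇔-to (th (ax (A1 φ (ψ ⇒ χ) ψ))) (pair v1 vz)))))

□-⇒-◇-mono : ∀ φ ψ χ → ⊢ ((φ □→ (ψ ⇒ χ)) ⇒ ((φ ◇→ ψ) ⇒ (φ ◇→ χ)))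
□-⇒-◇-mono φ ψ χ = closed (lam (lam
  (th (◇-mono-⊢ φ (closed (lam (snd vz · fst vz))))
   · (th (ax (A2 φ ψ (ψ ⇒ χ))) · pair vz v1))))

◇-mp : ∀ φ ψ χ → ⊢ ((φ □→ ψ) ⇒ ((φ ◇→ (ψ ⇒ χ)) ⇒ (φ ◇→ χ)))
◇-mp φ ψ χ = closed (lam (lam
  (th (◇-mono-⊢ φ (closed (lam (fst vz · snd vz))))
   · (th (ax (A2 φ (ψ ⇒ χ) ψ)) · pair vz v1))))

¬◇⇔□¬ : ∀ φ ψ → ⊢ (¬' (φ ◇→ ψ) ⇔ (φ □→ ¬' ψ))
¬◇⇔□¬ φ ψ = closed (pair
  (lam (th (ax (A4 φ ψ ⊥')) · lam (efq (v1 · vz))))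
  (lam (lam (th (ax (A6 φ)) · (th (□-⇒-◇-mono φ ψ ⊥') · v1 · vz)))))

lemma4 : ∀ (φ ψ χ : Form) →
    (φ ⊢from (ψ □→ φ))
    × ((φ ⇒ ψ) ⊢from ((χ □→ φ) ⇒ (χ □→ ψ)))
    × ((φ ⇒ ψ) ⊢from ((χ ◇→ φ) ⇒ (χ ◇→ ψ)))
    × (⊢ ((φ □→ (ψ ⇒ χ)) ⇒ ((φ □→ ψ) ⇒ (φ □→ χ))))
    × (⊢ ((φ □→ (ψ ⇒ χ)) ⇒ ((φ ◇→ ψ) ⇒ (φ ◇→ χ))))
    × (⊢ ((φ □→ ψ) ⇒ ((φ ◇→ (ψ ⇒ χ)) ⇒ (φ ◇→ χ))))
    × (⊢ (¬' (φ ◇→ ψ) ⇔ (φ □→ ¬' ψ)))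
lemma4 φ ψ χ =
  □-nec ψ hyp , □-mono χ hyp , ◇-mono χ hyp ,
  □-distrib-⇒ φ ψ χ , □-⇒-◇-mono φ ψ χ , ◇-mp φ ψ χ , ¬◇⇔□¬ φ ψ
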